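{- Let $H$ be a graph with even girth $g$ whose edges are colored RED or GREEN, with at most $\lfloor 3g/4\rfloor$ GREEN edges, and suppose $H$ has no GREEN-dominated cycle. Let $v_0$ be a vertex of $H$ and let $V'$ be the set of vertices visited by the colored BFS procedure started from $Z=\{v_0\}$. Then there is a safe orientation of the edges of $H$ incident on $V'$.
   Context: Graphs are finite and simple; girth is the length of a shortest cycle. Colored BFS from a nonempty vertex set $Z$: put all vertices of $Z$ in a queue and mark them GREEN. While the queue is nonempty, pop a vertex $v$. If $v$ is marked GREEN, then for each unmarked neighbor $w$ of $v$: push $w$, add the edge $\{v,w\}$ to the forest, and mark $w$ GREEN if $\{v,w\}$ is a GREEN edge, RED otherwise. If $v$ is marked RED, then for each unmarked neighbor $w$ with $\{v,w\}$ a GREEN edge: push $w$, add $\{v,w\}$ to the forest and mark $w$ GREEN. The visited vertices are those that get marked. A cycle is GREEN-dominated if, traversing it in some direction, all but at most one of its RED edges are immediately followed by a GREEN edge. A safe orientation of the edges incident on $V'$ is an assignment of a direction to every edge having at least one endpoint in $V'$ such that every vertex having an incoming GREEN edge (among these edges) has exactly one incoming edge among them. -}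

module Defs where

open import Data.Nat using (ℕ; zero; suc; _+_; _≤_; _<_; _<?_; s≤s)
open import Data.Fin using (Fin; toℕ; fromℕ<; _≟_)
open import Data.Bool using (Bool; true; false; _∧_; not; if_then_else_)
open import Data.List using (List; []; _∷_; _++_; [_]; foldl)
open import Data.Product using (Σ; _×_; _,_; proj₁)
open import Data.Sum using (_⊎_)
open import Relation.Nullary using (¬_; yes; no; does)
open import Relation.Binary.PropositionalEquality using (_≡_)

data Color : Set where
  red green : Color

data Mark : Set where
  unmarked markGreen markRed : Mark

isRed : Color → Bool
isRed red = true
isRed green = false

isGreen : Color → Bool
isGreen red = false
isGreen green = true

-- A finite simple graph on vertex set Fin n whose edges are coloured RED/GREEN.
-- adj is a symmetric irreflexive adjacency; col is the colour of edge {u,v}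
-- (its values on non-edges are irrelevant).
record ColoredGraph (n : ℕ) : Set where
  field
    adj        : Fin n → Fin n → Bool
    adj-sym    : ∀ u v → adj u v ≡ adj v u
    adj-irrefl : ∀ v → adj v v ≡ false
    col        : Fin n → Fin n → Color
    col-sym    : ∀ u v → col u v ≡ col v u

open ColoredGraph public

count : ∀ {k} → (Fin k → Bool) → ℕ
count {zero} p = 0
count {suc k} p = (if p Fin.zero then 1 else 0) + count (λ i → p (Fin.suc i))

sumFin : ∀ {k} → (Fin k → ℕ) → ℕ
sumFin {zero} f = 0
sumFin {suc k} f = f Fin.zero + sumFin (λ i → f (Fin.suc i))

greenEdges : ∀ {n} → ColoredGraph n → ℕ
greenEdges {n} H =
  sumFin (λ u → count (λ v → does (toℕ u <? toℕ v) ∧ adj H u v ∧ isGreen (col H u v)))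

next : ∀ {k} → Fin k → Fin k
next {suc m} i with toℕ i <? m
... | yes p = fromℕ< (s≤s p)
... | no _  = Fin.zero

IsCycle : ∀ {n} → ColoredGraph n → (k : ℕ) → (Fin k → Fin n) → Set
IsCycle H k c =
  (3 ≤ k) × (∀ i j → c i ≡ c j → i ≡ j) × (∀ i → adj H (c i) (c (next i)) ≡ true)

Girth : ∀ {n} → ColoredGraph n → ℕ → Set
Girth {n} H g =
  (Σ (Fin g → Fin n) λ c → IsCycle H g c) × (∀ k (c : Fin k → Fin n) → IsCycle H k c → g ≤ k)

-- Traversing c in the given direction, edge i is {c i, c (next i)}; it is followed by
-- edge (next i).  GREEN-dominated in this direction: at most one RED edge is NOT
-- immediately followed by a GREEN edge (i.e. is followed by a RED edge).
-- (The other direction is covered since reversals of cycles are cycles.)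
GreenDominatedDir : ∀ {n} → ColoredGraph n → (k : ℕ) → (Fin k → Fin n) → Set
GreenDominatedDir H k c =
  count (λ i → isRed (col H (c i) (c (next i))) ∧ isRed (col H (c (next i)) (c (next (next i))))) ≤ 1

setMark : ∀ {n} → (Fin n → Mark) → Fin n → Mark → (Fin n → Mark)
setMark ms w m x = if does (x ≟ w) then m else ms x

colorMark : Color → Mark
colorMark red = markRed
colorMark green = markGreen

isGreenMark : Mark → Bool
isGreenMark markGreen = true
isGreenMark _ = false

bfsVisit : ∀ {n} → ColoredGraph n → Fin n → Mark →
           (Fin n → Mark) × List (Fin n) → Fin n → (Fin n → Mark) × List (Fin n)
bfsVisit H v mv (ms , q) w with adj H v w | ms w
... | true | unmarked =
  if isGreenMark mv Data.Bool.∨ isGreen (col H v w)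
  then (setMark ms w (colorMark (col H v w)) , q ++ [ w ])
  else (ms , q)
... | _ | _ = (ms , q)

-- main loop with fuel; ord v is the order in which neighbours of v are scanned
bfsLoop : ∀ {n} → ColoredGraph n → (Fin n → List (Fin n)) → ℕ →
          (Fin n → Mark) → List (Fin n) → (Fin n → Mark)
bfsLoop H ord zero ms q = ms
bfsLoop H ord (suc f) ms [] = ms
bfsLoop H ord (suc f) ms (v ∷ q) with foldl (bfsVisit H v (ms v)) (ms , q) (ord v)
... | (ms' , q') = bfsLoop H ord f ms' q'

-- final marks of colored BFS from Z = {v0}.  Each vertex is pushed at most once
-- (it is marked when pushed), so n pops suffice; we give fuel suc n.
bfsMarks : ∀ {n} → ColoredGraph n → (Fin n → List (Fin n)) → Fin n → (Fin n → Mark)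
bfsMarks {n} H ord v0 =
  bfsLoop H ord (suc n) (setMark (λ _ → unmarked) v0 markGreen) (v0 ∷ [])

Visited : ∀ {n} → ColoredGraph n → (Fin n → List (Fin n)) → Fin n → Fin n → Set
Visited H ord v0 x = ¬ (bfsMarks H ord v0 x ≡ unmarked)

Incident : ∀ {n} → (Fin n → Set) → Fin n → Fin n → Set
Incident V' u v = V' u ⊎ V' v

-- dir u v ≡ true means the edge {u,v} is oriented u → v.
SafeOrientation : ∀ {n} → ColoredGraph n → (Fin n → Set) → Set
SafeOrientation {n} H V' =
  Σ (Fin n → Fin n → Bool) λ dir →
    (∀ u v → adj H u v ≡ true → Incident V' u v → dir u v ≡ not (dir v u)) ×
    (∀ w u → adj H u w ≡ true → Incident V' u w → dir u w ≡ true → col H u w ≡ green →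
       ∀ x y →
       adj H x w ≡ true → Incident V' x w → dir x w ≡ true →
       adj H y w ≡ true → Incident V' y w → dir y w ≡ true →
       x ≡ y)

module Submission where

-- Without GREEN-dominated cycles every nonempty vertex set S contains a vertex
-- that can be peeled off: all its edges into S are RED, or it has at most one
-- neighbour in S.  Otherwise one can walk inside S forever, never backtracking
-- and never taking two RED edges in a row (after a RED edge leave along a GREEN
-- one, after a GREEN edge along any other edge); the first repeated vertex
-- closes a cycle in which only the closing turn can be RED–RED, i.e. a
-- GREEN-dominated cycle.  Peeling all vertices one by one and orienting every
-- edge towards the endpoint peeled first gives a safe orientation of ALL edges
-- of H.

open import Defs
open import Data.Bool using (Bool; true; false; _∧_; not; if_then_else_)
open import Data.Bool.Properties using (T-≡) renaming (_≟_ to _≟ᵇ_)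
open import Data.Empty using (⊥; ⊥-elim)
open import Data.Fin using (Fin; toℕ; _≟_)
open import Data.Fin.Properties using (toℕ-fromℕ<; toℕ-injective; toℕ<n; toℕ≤pred[n]; any?; pigeonhole)
open import Data.Fin.Subset using (Subset; ⊤; _-_; ∣_∣; Nonempty) renaming (_∈_ to _∈ˢ_)
open import Data.Fin.Subset.Properties using (_∈?_; nonempty?; ∈⊤; x∈p∧x≢y⇒x∈p-y; x∈p⇒∣p-x∣<∣p∣)
open import Data.List using (List)
open import Data.List.Membership.Propositional using (_∈_)
open import Data.Nat using (ℕ; zero; suc; _+_; _*_; _≤_; _<_; _<?_; z≤n; s≤s; s<s⁻¹)
open import Data.Nat.DivMod using (_/_)
open import Data.Nat.Divisibility using (_∣_)
open import Data.Nat.Induction using (<-wellFounded)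
open import Data.Nat.Properties
  using (≤-antisym; ≮⇒≥; <-cmp; <-asym; <-irrefl; n≮0; 0≢1+n; n<1+n; suc-injective;
         +-suc; +-identityʳ; +-comm; <ᵇ⇒<; +-monoʳ-<; m≤n⇒∃[o]m+o≡n; anyUpTo?)
open import Data.Product using (∃; ∃₂; _×_; _,_; proj₁; proj₂)
open import Data.Sum using (_⊎_; inj₁; inj₂)
open import Function.Bundles using (Equivalence)
open import Induction.WellFounded using (Acc; acc)
open import Relation.Binary using (tri<; tri≈; tri>)
open import Relation.Binary.PropositionalEquality using (_≡_; _≢_; refl; sym; trans; cong; subst; module ≡-Reasoning)
open import Relation.Nullary using (¬_; Dec; yes; no; does)
open import Relation.Nullary.Decidable using (_×-dec_; ¬?; decidable-stable; dec-true; dec-false)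
open import Relation.Unary using (Decidable)

count-onlyLast≤1 : ∀ {k} (p : Fin k → Bool) → (∀ t → suc (toℕ t) < k → p t ≡ false) → count p ≤ 1
count-onlyLast≤1 {zero} p _ = z≤n
count-onlyLast≤1 {suc zero} p _ with p Fin.zero
... | true = s≤s z≤n
... | false = z≤n
count-onlyLast≤1 {suc (suc k)} p notLast =
  subst (λ b → (if b then 1 else 0) + count (λ t → p (Fin.suc t)) ≤ 1)
        (sym (notLast Fin.zero (s≤s (s≤s z≤n))))
        (count-onlyLast≤1 (λ t → p (Fin.suc t)) (λ t lt → notLast (Fin.suc t) (s≤s lt)))

3≤1+n : ∀ {o} → o ≢ 0 → o ≢ 1 → 3 ≤ suc o
3≤1+n {zero} o≢0 _ = ⊥-elim (o≢0 refl)
3≤1+n {suc zero} _ o≢1 = ⊥-elim (o≢1 refl)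
3≤1+n {suc (suc _)} _ _ = s≤s (s≤s (s≤s z≤n))

next-cases : ∀ {m} (t : Fin (suc m)) →
             (suc (toℕ t) < suc m × toℕ (next t) ≡ suc (toℕ t)) ⊎ (toℕ t ≡ m × next t ≡ Fin.zero)
next-cases {m} t with toℕ t <? m
... | yes t<m = inj₁ (s≤s t<m , toℕ-fromℕ< (s≤s t<m))
... | no t≮m = inj₂ (≤-antisym (toℕ≤pred[n] t) (≮⇒≥ t≮m) , refl)

LeastWitness : (ℕ → Set) → Set
LeastWitness P = ∃ λ m → P m × (∀ {k} → k < m → ¬ P k)

leastWitness : ∀ {P : ℕ → Set} → Decidable P → ∀ {m} → P m → LeastWitness P
leastWitness {P} P? {m} = search (<-wellFounded m)
  where
  search : ∀ {m} → Acc _<_ m → P m → LeastWitness P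
  search {m} (acc smaller) pm with anyUpTo? P? m
  ... | yes (k , k<m , pk) = search (smaller k<m) pk
  ... | no none = m , pm , λ k<m pk → none (_ , k<m , pk)

_≟ᶜ_ : (a b : Color) → Dec (a ≡ b)
red ≟ᶜ red = yes refl
red ≟ᶜ green = no λ ()
green ≟ᶜ red = no λ ()
green ≟ᶜ green = yes refl

notGreen⇒red : ∀ {c} → c ≢ green → c ≡ red
notGreen⇒red {red} _ = refl
notGreen⇒red {green} c≢green = ⊥-elim (c≢green refl)

greenAfterRed⇒¬redRed : ∀ {c₁ c₂} → (c₁ ≡ red → c₂ ≡ green) → (isRed c₁ ∧ isRed c₂) ≡ false
greenAfterRed⇒¬redRed {green} _ = refl
greenAfterRed⇒¬redRed {red} c₂-green rewrite c₂-green refl = refl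

module _ {n : ℕ} (H : ColoredGraph n) where

  record RedRedFreeWalk : Set where
    field
      vertex          : ℕ → Fin n
      adjacent        : ∀ k → adj H (vertex k) (vertex (suc k)) ≡ true
      nonBacktracking : ∀ k → vertex (suc (suc k)) ≢ vertex k
      greenAfterRed   : ∀ k → col H (vertex k) (vertex (suc k)) ≡ red →
                        col H (vertex (suc k)) (vertex (suc (suc k))) ≡ green

  module _ (W : RedRedFreeWalk) where
    open RedRedFreeWalk W

    firstRepetition : ∃₂ λ a b → a < b × vertex a ≡ vertex b ×
                                 (∀ {i j} → i < j → j < b → vertex i ≢ vertex j)
    firstRepetition with pigeonhole (n<1+n n) (λ (t : Fin (suc n)) → vertex (toℕ t))
    ... | i , j , i<j , same with leastWitness repeats? (toℕ i , i<j , same)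
      where
      repeats? : Decidable λ b → ∃ λ a → a < b × vertex a ≡ vertex b
      repeats? b = anyUpTo? (λ a → vertex a ≟ vertex b) b
    ... | b , (a , a<b , same′) , noEarlier =
      a , b , a<b , same′ , λ i<j j<b same″ → noEarlier j<b (_ , i<j , same″)

    module ClosedSegment (a o : ℕ) (closes : vertex a ≡ vertex (suc (a + o)))
                         (injective : ∀ {i j} → i < j → j < suc (a + o) → vertex i ≢ vertex j) where

      cycle : Fin (suc o) → Fin n
      cycle t = vertex (a + toℕ t)

      cycle-next : ∀ t → cycle (next t) ≡ vertex (suc (a + toℕ t))
      cycle-next t with next-cases t
      ... | inj₁ (_ , next≡suc) = trans (cong (λ i → vertex (a + i)) next≡suc) (cong vertex (+-suc a (toℕ t)))
      ... | inj₂ (t≡o , next≡0) = begin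
        cycle (next t)           ≡⟨ cong cycle next≡0 ⟩
        vertex (a + 0)           ≡⟨ cong vertex (+-identityʳ a) ⟩
        vertex a                 ≡⟨ closes ⟩
        vertex (suc (a + o))     ≡⟨ cong (λ i → vertex (suc (a + i))) t≡o ⟨
        vertex (suc (a + toℕ t)) ∎
        where open ≡-Reasoning

      inSegment : ∀ t → a + toℕ t < suc (a + o)
      inSegment t = subst (a + toℕ t <_) (+-suc a o) (+-monoʳ-< a (toℕ<n t))

      cycle-injective : ∀ s t → cycle s ≡ cycle t → s ≡ t
      cycle-injective s t same with <-cmp (toℕ s) (toℕ t)
      ... | tri< s<t _ _ = ⊥-elim (injective (+-monoʳ-< a s<t) (inSegment t) same)
      ... | tri≈ _ s≡t _ = toℕ-injective s≡t
      ... | tri> _ _ t<s = ⊥-elim (injective (+-monoʳ-< a t<s) (inSegment s) (sym same))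

      cycle-adjacent : ∀ t → adj H (cycle t) (cycle (next t)) ≡ true
      cycle-adjacent t rewrite cycle-next t = adjacent (a + toℕ t)

      closesAfter : ∀ {m} → o ≡ m → vertex a ≡ vertex (suc (a + m))
      closesAfter refl = closes

      noLoop : o ≢ 0
      noLoop o≡0 with trans (sym (adj-irrefl H (vertex a))) (subst (λ v → adj H (vertex a) v ≡ true) (sym closes′) (adjacent a))
        where
        closes′ : vertex a ≡ vertex (suc a)
        closes′ = trans (closesAfter o≡0) (cong (λ i → vertex (suc i)) (+-identityʳ a))
      ... | ()

      noBacktrack : o ≢ 1
      noBacktrack o≡1 = nonBacktracking a (sym (trans (closesAfter o≡1) (cong (λ i → vertex (suc i)) (+-comm a 1))))

      onlyClosingTurnRedRed : ∀ t → suc (toℕ t) < suc o →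
        (isRed (col H (cycle t) (cycle (next t))) ∧ isRed (col H (cycle (next t)) (cycle (next (next t))))) ≡ false
      onlyClosingTurnRedRed t t<o with next-cases t
      ... | inj₂ (t≡o , _) = ⊥-elim (<-irrefl (cong suc t≡o) t<o)
      ... | inj₁ (_ , next≡suc) rewrite cycle-next t | cycle-next (next t) | next≡suc | +-suc a (toℕ t) =
        greenAfterRed⇒¬redRed (greenAfterRed (a + toℕ t))

      greenDominated : IsCycle H (suc o) cycle × GreenDominatedDir H (suc o) cycle
      greenDominated = (3≤1+n noLoop noBacktrack , cycle-injective , cycle-adjacent) , count-onlyLast≤1 _ onlyClosingTurnRedRed

    redRedFreeWalk⇒greenDominatedCycle : ∃₂ λ k c → IsCycle H k c × GreenDominatedDir H k c
    redRedFreeWalk⇒greenDominatedCycle with firstRepetition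
    ... | a , b , a<b , same , injective with m≤n⇒∃[o]m+o≡n a<b
    ... | o , refl = suc o , ClosedSegment.cycle a o same injective , ClosedSegment.greenDominated a o same injective

  GreenNeighbour : (Fin n → Set) → Fin n → Set
  GreenNeighbour S v = ∃ λ u → S u × adj H v u ≡ true × col H v u ≡ green

  OtherNeighbour : (Fin n → Set) → Fin n → Fin n → Set
  OtherNeighbour S v p = ∃ λ u → S u × adj H v u ≡ true × u ≢ p

  module _ (S : Fin n → Set)
           (greenNeighbour : ∀ {v} → S v → GreenNeighbour S v)
           (otherNeighbour : ∀ {v p} → S v → S p → adj H v p ≡ true → OtherNeighbour S v p) where

    record Dart : Set where
      field
        tail head : Fin n
        tail∈S    : S tail
        head∈S    : S head
        adjacent  : adj H tail head ≡ true
    open Dart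

    continuation : (d : Dart) → ∃ λ u → S u × adj H (head d) u ≡ true × u ≢ tail d ×
                                 (col H (tail d) (head d) ≡ red → col H (head d) u ≡ green)
    continuation d with col H (tail d) (head d) in colour
    ... | red with greenNeighbour (head∈S d)
    ...   | u , u∈S , adjacent′ , green′ = u , u∈S , adjacent′ , backtracks , λ _ → green′
      where
      backtracks : u ≢ tail d
      backtracks refl with trans (sym colour) (trans (col-sym H (tail d) (head d)) green′)
      ... | ()
    continuation d | green with otherNeighbour (head∈S d) (tail∈S d) (trans (adj-sym H (head d) (tail d)) (adjacent d))
    ...   | u , u∈S , adjacent′ , u≢tail = u , u∈S , adjacent′ , u≢tail , λ ()

    advance : Dart → Dart
    advance d = record { tail = head d ; head = proj₁ (continuation d) ; tail∈S = head∈S d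
                       ; head∈S = proj₁ (proj₂ (continuation d)) ; adjacent = proj₁ (proj₂ (proj₂ (continuation d))) }

    branchingWalk : ∀ {v} → S v → RedRedFreeWalk
    branchingWalk {v} v∈S = record
      { vertex          = λ k → tail (darts k)
      ; adjacent        = λ k → adjacent (darts k)
      ; nonBacktracking = λ k → proj₁ (proj₂ (proj₂ (proj₂ (continuation (darts k)))))
      ; greenAfterRed   = λ k → proj₂ (proj₂ (proj₂ (proj₂ (continuation (darts k)))))
      }
      where
      first : Dart
      first with greenNeighbour v∈S
      ... | u , u∈S , vu , _ = record { tail = v ; head = u ; tail∈S = v∈S ; head∈S = u∈S ; adjacent = vu }
      darts : ℕ → Dart
      darts zero = first
      darts (suc k) = advance (darts k)

  Peelable : (Fin n → Set) → Fin n → Set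
  Peelable S v = (∀ {u} → S u → adj H v u ≡ true → col H v u ≡ red)
               ⊎ (∀ {x y} → S x → S y → adj H v x ≡ true → adj H v y ≡ true → x ≡ y)

  Peelable-mono : ∀ {S T : Fin n → Set} {v} → (∀ {u} → T u → S u) → Peelable S v → Peelable T v
  Peelable-mono T⊆S (inj₁ allRed) = inj₁ λ u∈T → allRed (T⊆S u∈T)
  Peelable-mono T⊆S (inj₂ unique) = inj₂ λ x∈T y∈T → unique (T⊆S x∈T) (T⊆S y∈T)

  noGreenNeighbour⇒peelable : ∀ {S v} → ¬ GreenNeighbour S v → Peelable S v
  noGreenNeighbour⇒peelable none = inj₁ λ u∈S vu → notGreen⇒red λ vu-green → none (_ , u∈S , vu , vu-green)

  noOtherNeighbour⇒peelable : ∀ {S v p} → ¬ OtherNeighbour S v p → Peelable S v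
  noOtherNeighbour⇒peelable {S} {v} {p} none = inj₂ λ x∈S y∈S vx vy → trans (onlyP x∈S vx) (sym (onlyP y∈S vy))
    where
    onlyP : ∀ {x} → S x → adj H v x ≡ true → x ≡ p
    onlyP {x} x∈S vx = decidable-stable (x ≟ p) λ x≢p → none (x , x∈S , vx , x≢p)

  NoGreenDominatedCycle : Set
  NoGreenDominatedCycle = ∀ k (c : Fin k → Fin n) → IsCycle H k c → ¬ GreenDominatedDir H k c

  greenNeighbour? : (alive : Subset n) → ∀ v → Dec (GreenNeighbour (_∈ˢ alive) v)
  greenNeighbour? alive v = any? λ u → (u ∈? alive) ×-dec (adj H v u ≟ᵇ true) ×-dec (col H v u ≟ᶜ green)

  otherNeighbour? : (alive : Subset n) → ∀ v p → Dec (OtherNeighbour (_∈ˢ alive) v p)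
  otherNeighbour? alive v p = any? λ u → (u ∈? alive) ×-dec (adj H v u ≟ᵇ true) ×-dec ¬? (u ≟ p)

  peelable-exists : NoGreenDominatedCycle → (alive : Subset n) → Nonempty alive →
                    ∃ λ v → v ∈ˢ alive × Peelable (_∈ˢ alive) v
  peelable-exists noGD alive (v₀ , v₀∈)
    with any? (λ v → (v ∈? alive) ×-dec ¬? (greenNeighbour? alive v))
  ... | yes (v , v∈ , none) = v , v∈ , noGreenNeighbour⇒peelable none
  ... | no everyGreen
    with any? (λ v → (v ∈? alive) ×-dec any? (λ p →
                     (p ∈? alive) ×-dec (adj H v p ≟ᵇ true) ×-dec ¬? (otherNeighbour? alive v p)))
  ... | yes (v , v∈ , p , p∈ , vp , none) = v , v∈ , noOtherNeighbour⇒peelable none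
  ... | no everyBranching = ⊥-elim dominatedCycle
    where
    greenExists : ∀ {v} → v ∈ˢ alive → GreenNeighbour (_∈ˢ alive) v
    greenExists {v} v∈ = decidable-stable (greenNeighbour? alive v) λ none → everyGreen (v , v∈ , none)
    otherExists : ∀ {v p} → v ∈ˢ alive → p ∈ˢ alive → adj H v p ≡ true → OtherNeighbour (_∈ˢ alive) v p
    otherExists {v} {p} v∈ p∈ vp =
      decidable-stable (otherNeighbour? alive v p) λ none → everyBranching (v , v∈ , p , p∈ , vp , none)
    dominatedCycle : ⊥
    dominatedCycle with redRedFreeWalk⇒greenDominatedCycle (branchingWalk (_∈ˢ alive) greenExists otherExists v₀∈)
    ... | k , c , isCycle , dominated = noGD k c isCycle dominated

  record PeelingRank (alive : Subset n) : Set where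
    field
      rank           : Fin n → ℕ
      rank-injective : ∀ {u v} → u ∈ˢ alive → v ∈ˢ alive → rank u ≡ rank v → u ≡ v
      peelable-above : ∀ {v} → v ∈ˢ alive → Peelable (λ u → u ∈ˢ alive × rank v < rank u) v

  emptyRank : ∀ {alive} → ¬ Nonempty alive → PeelingRank alive
  emptyRank empty = record
    { rank = λ _ → 0
    ; rank-injective = λ u∈ _ _ → ⊥-elim (empty (_ , u∈))
    ; peelable-above = λ v∈ → ⊥-elim (empty (_ , v∈))
    }

  peel : ∀ {alive p} → p ∈ˢ alive → Peelable (_∈ˢ alive) p → PeelingRank (alive - p) → PeelingRank alive
  peel {alive} {p} p∈ p-peelable R = record
    { rank = rank ; rank-injective = rank-injective ; peelable-above = peelable-above }
    where
    open PeelingRank R renaming (rank to rank′; rank-injective to rank′-injective; peelable-above to peelable-above′)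

    rank : Fin n → ℕ
    rank u with u ≟ p
    ... | yes _ = 0
    ... | no _ = suc (rank′ u)

    rank-p : rank p ≡ 0
    rank-p with p ≟ p
    ... | yes _ = refl
    ... | no p≢p = ⊥-elim (p≢p refl)

    rank-other : ∀ {u} → u ≢ p → rank u ≡ suc (rank′ u)
    rank-other {u} u≢p with u ≟ p
    ... | yes u≡p = ⊥-elim (u≢p u≡p)
    ... | no _ = refl

    rank-injective : ∀ {u v} → u ∈ˢ alive → v ∈ˢ alive → rank u ≡ rank v → u ≡ v
    rank-injective {u} {v} u∈ v∈ same with u ≟ p | v ≟ p
    ... | yes refl | yes refl = refl
    ... | yes refl | no v≢p = ⊥-elim (0≢1+n same)
    ... | no u≢p | yes refl = ⊥-elim (0≢1+n (sym same))
    ... | no u≢p | no v≢p = rank′-injective (x∈p∧x≢y⇒x∈p-y u∈ u≢p) (x∈p∧x≢y⇒x∈p-y v∈ v≢p) (suc-injective same)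

    peelable-above : ∀ {v} → v ∈ˢ alive → Peelable (λ u → u ∈ˢ alive × rank v < rank u) v
    peelable-above {v} v∈ with v ≟ p
    ... | yes refl = Peelable-mono proj₁ p-peelable
    ... | no v≢p = Peelable-mono above′ (peelable-above′ (x∈p∧x≢y⇒x∈p-y v∈ v≢p))
      where
      above′ : ∀ {u} → u ∈ˢ alive × suc (rank′ v) < rank u → u ∈ˢ alive - p × rank′ v < rank′ u
      above′ {u} (u∈ , v<u) = x∈p∧x≢y⇒x∈p-y u∈ u≢p , s<s⁻¹ (subst (suc (rank′ v) <_) (rank-other u≢p) v<u)
        where
        u≢p : u ≢ p
        u≢p refl = n≮0 (subst (suc (rank′ v) <_) rank-p v<u)

  peelingRank : NoGreenDominatedCycle → (alive : Subset n) → PeelingRank alive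
  peelingRank noGD alive = peelAll (<-wellFounded ∣ alive ∣)
    where
    peelAll : ∀ {alive} → Acc _<_ ∣ alive ∣ → PeelingRank alive
    peelAll {alive} (acc smaller) with nonempty? alive
    ... | no empty = emptyRank empty
    ... | yes nonempty with peelable-exists noGD alive nonempty
    ... | p , p∈ , p-peelable = peel p∈ p-peelable (peelAll (smaller (x∈p⇒∣p-x∣<∣p∣ p∈)))

  rankedOrientation : (rank : Fin n → ℕ) → (∀ {u v} → rank u ≡ rank v → u ≡ v) →
                      (∀ v → Peelable (λ u → rank v < rank u) v) → (V′ : Fin n → Set) → SafeOrientation H V′
  rankedOrientation rank injective peelable V′ = orient , antisymmetric , safe
    where
    orient : Fin n → Fin n → Bool
    orient u v = does (rank v <? rank u)

    orient⇒< : ∀ {u v} → orient u v ≡ true → rank v < rank u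
    orient⇒< {u} {v} oriented = <ᵇ⇒< (rank v) (rank u) (Equivalence.from T-≡ oriented)

    antisymmetric : ∀ u v → adj H u v ≡ true → Incident V′ u v → orient u v ≡ not (orient v u)
    antisymmetric u v uv _ with <-cmp (rank v) (rank u)
    ... | tri< v<u _ _ rewrite dec-true (rank v <? rank u) v<u | dec-false (rank u <? rank v) (<-asym v<u) = refl
    ... | tri> _ _ u<v rewrite dec-false (rank v <? rank u) (<-asym u<v) | dec-true (rank u <? rank v) u<v = refl
    ... | tri≈ _ same _ with injective (sym same)
    ...   | refl with trans (sym (adj-irrefl H u)) uv
    ...     | ()

    safe : ∀ w u → adj H u w ≡ true → Incident V′ u w → orient u w ≡ true → col H u w ≡ green →
           ∀ x y → adj H x w ≡ true → Incident V′ x w → orient x w ≡ true →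
                   adj H y w ≡ true → Incident V′ y w → orient y w ≡ true → x ≡ y
    safe w u uw _ uw-in uw-green x y xw _ xw-in yw _ yw-in with peelable w
    ... | inj₁ allRed with trans (sym uw-green) (trans (col-sym H u w) (allRed (orient⇒< uw-in) (trans (adj-sym H w u) uw)))
    ...   | ()
    safe w u uw _ uw-in uw-green x y xw _ xw-in yw _ yw-in | inj₂ unique =
      unique (orient⇒< xw-in) (orient⇒< yw-in) (trans (adj-sym H w x) xw) (trans (adj-sym H w y) yw)

lemma11 : (n : ℕ) (H : ColoredGraph n) (g : ℕ) →
          Girth H g → 2 ∣ g → greenEdges H ≤ (3 * g) / 4 →
          (∀ k (c : Fin k → Fin n) → IsCycle H k c → ¬ GreenDominatedDir H k c) →
          (v0 : Fin n) (ord : Fin n → List (Fin n)) → (∀ v w → w ∈ ord v) →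
          SafeOrientation H (Visited H ord v0)
lemma11 n H g _ _ _ noGD v0 ord _ =
  rankedOrientation H rank (rank-injective ∈⊤ ∈⊤) (λ v → Peelable-mono H (∈⊤ ,_) (peelable-above ∈⊤))
    (Visited H ord v0)
  where open PeelingRank (peelingRank H noGD ⊤)
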